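{- Let $w\in\mathfrak{S}_n$ avoid the pattern $4231$, and suppose $(p,q)$ and $(q,r)$ are both minimal inversions of $w$. Then both $wt_{pq}$ and $wt_{qr}$ cover both $wt_{pq}t_{qr}$ and $wt_{qr}t_{pq}$ in the Bruhat interval $[e,w]$.
   Context: For $i\ne j$, $t_{ij}$ denotes the transposition $(i\ j)$, and $wt_{ij}$ is the permutation obtained from $w$ (in one-line notation) by swapping the entries in positions $i$ and $j$. An inversion $(i,j)$ of $w$ is minimal if $i<j$, $w(i)>w(j)$, and there is no $k$ with $i<k<j$ and $w(i)>w(k)>w(j)$. Bruhat order on $\mathfrak{S}_n$ is the transitive closure of $w<wt$ for transpositions $t$ with $\ell(wt)>\ell(w)$, $\ell$ being the number of inversions; $[e,w]=\{u:u\le w\}$. Avoiding $4231$ means there are no indices $i_1<i_2<i_3<i_4$ with $w(i_4)<w(i_2)<w(i_3)<w(i_1)$. -}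

module Defs where

open import Data.Nat using (ℕ; _<_)
open import Data.Fin using (Fin)
import Data.Fin as F
open import Data.Fin.Permutation public
  using (Permutation′; _⟨$⟩ʳ_; _∘ₚ_; transpose)
open import Data.List using (List; length; filter; allFin; cartesianProduct)
open import Data.Product using (_×_; _,_; ∃; ∃-syntax; Σ)
open import Relation.Nullary using (¬_)
open import Relation.Nullary.Decidable using (_×-dec_)
open import Relation.Binary.PropositionalEquality using (_≡_)
open import Relation.Binary.Construct.Closure.Transitive using (TransClosure)
open import Data.Sum using (_⊎_)

private variable n : ℕ

-- w t_{ij} : permutation obtained from w by swapping the entries in positions i and j,
-- i.e. k ↦ w (t_{ij} k).  (π₁ ∘ₚ π₂ applies π₁ first, then π₂.)
_·t[_,_] : Permutation′ n → Fin n → Fin n → Permutation′ n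
w ·t[ i , j ] = transpose i j ∘ₚ w

ℓ : Permutation′ n → ℕ
ℓ {n} w = length (filter (λ (ij : Fin n × Fin n) → let (i , j) = ij in
                          (i F.<? j) ×-dec ((w ⟨$⟩ʳ j) F.<? (w ⟨$⟩ʳ i)))
                         (cartesianProduct (allFin n) (allFin n)))

_≈ₚ_ : Permutation′ n → Permutation′ n → Set
u ≈ₚ v = ∀ i → u ⟨$⟩ʳ i ≡ v ⟨$⟩ʳ i

BruhatStep : Permutation′ n → Permutation′ n → Set
BruhatStep {n} u v = ∃[ i ] ∃[ j ] (¬ i ≡ j × v ≈ₚ (u ·t[ i , j ]) × ℓ u < ℓ v)

_<B_ : Permutation′ n → Permutation′ n → Set
_<B_ = TransClosure BruhatStep

_≤B_ : Permutation′ n → Permutation′ n → Set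
u ≤B v = u ≈ₚ v ⊎ u <B v

CoversIn : Permutation′ n → Permutation′ n → Permutation′ n → Set
CoversIn w u v =
  u ≤B w × v ≤B w × u <B v ×
  (∀ z → z ≤B w → ¬ (u <B z × z <B v))

MinimalInversion : Permutation′ n → Fin n → Fin n → Set
MinimalInversion w i j =
  i F.< j × (w ⟨$⟩ʳ j) F.< (w ⟨$⟩ʳ i) ×
  (∀ k → i F.< k → k F.< j →
    ¬ ((w ⟨$⟩ʳ j) F.< (w ⟨$⟩ʳ k) × (w ⟨$⟩ʳ k) F.< (w ⟨$⟩ʳ i)))

Avoids4231 : Permutation′ n → Set
Avoids4231 w = ∀ i₁ i₂ i₃ i₄ → i₁ F.< i₂ → i₂ F.< i₃ → i₃ F.< i₄ →
  ¬ ((w ⟨$⟩ʳ i₄) F.< (w ⟨$⟩ʳ i₂) × (w ⟨$⟩ʳ i₂) F.< (w ⟨$⟩ʳ i₃) ×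
     (w ⟨$⟩ʳ i₃) F.< (w ⟨$⟩ʳ i₁))

-- All four relations are assembled from Bruhat steps u → u t_{ij} along a minimal
-- non-inversion (i , j) of u: i < j, u(i) < u(j), and no position strictly between
-- i and j carries a value strictly between u(i) and u(j). Such a step creates the
-- inversion (i , j) and no other net inversion, so it raises ℓ by exactly one; as ℓ
-- strictly increases along <B, a step u → v of this kind followed by a step v → w
-- makes v cover u in [e , w].
-- The steps w t_{pq} → w and w t_{qr} → w run along the minimal inversions (p , q)
-- and (q , r). The four steps out of w t_{pq} t_{qr} and w t_{qr} t_{pq} are minimal
-- because no position k ≠ q strictly between p and r has w(r) < w(k) < w(p): such a
-- k would form a 4231 pattern with p, q, r, or contradict the minimality of (p , q)
-- or (q , r).
module Submission where

open import Defs
open import Level using (Level)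
open import Data.Bool using (true; false; if_then_else_)
open import Data.Fin using (Fin; _<_; _<?_; punchIn)
open import Data.Fin.Properties using (_≟_; punchInᵢ≢i; <-cmp; <-asym; <-trans; <-irrefl; <⇒≢)
import Data.Fin.Permutation.Components as PC
open import Data.List using (List; _++_; length; filter; map; tabulate; allFin; cartesianProduct)
open import Data.List.Properties using (filter-++; length-++; map-tabulate)
open import Data.Nat using (ℕ; zero; suc; _+_)
import Data.Nat as ℕ
open import Data.Nat.Properties
  using ( +-assoc; +-comm; +-suc; +-cancelʳ-≡; ≤-reflexive; <⇒≱; m<1+n⇒m≤n
        ; +-0-commutativeMonoid; +-commutativeSemigroup )
import Data.Nat.Properties as ℕ
open import Algebra.Properties.CommutativeMonoid.Sum +-0-commutativeMonoid
  using (sum; sum-syntax; sum-remove; sum-cong-≗; ∑-distrib-+)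
open import Algebra.Properties.CommutativeSemigroup +-commutativeSemigroup
  using (xy∙z≈zy∙x; xy∙z≈xz∙y)
open import Data.Product using (_×_; _,_; proj₁; proj₂)
open import Data.Sum using (_⊎_; inj₁; inj₂)
open import Data.Vec.Functional using (removeAt; updateAt)
open import Data.Vec.Functional.Properties using (updateAt-updates; updateAt-minimal)
open import Function using (_∘_; id; _⇔_; mk⇔)
open import Function.Bundles using (Injection)
open import Function.Definitions using (Injective)
open import Function.Properties.Inverse using (↔⇒↣)
open import Relation.Binary.Construct.Closure.Transitive using ([_]; _∷_)
open import Relation.Binary.Definitions using (tri<; tri≈; tri>)
open import Relation.Binary.PropositionalEquality
open import Relation.Nullary using (Dec; does; ¬_; yes; no; contradiction)
open import Relation.Nullary.Decidable using (_×-dec_; does-⇔; dec-true; dec-false)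
open import Relation.Unary using (Pred; Decidable)

private variable
  α ρ : Level
  A B : Set α
  m n : ℕ

𝟙 : Dec A → ℕ
𝟙 a? = if does a? then 1 else 0

𝟙-⇔ : A ⇔ B → (a? : Dec A) (b? : Dec B) → 𝟙 a? ≡ 𝟙 b?
𝟙-⇔ A⇔B a? b? = cong (λ x → if x then 1 else 0) (does-⇔ A⇔B a? b?)

𝟙-yes : (a? : Dec A) → A → 𝟙 a? ≡ 1
𝟙-yes a? x rewrite dec-true a? x = refl

𝟙-no : (a? : Dec A) → ¬ A → 𝟙 a? ≡ 0
𝟙-no a? ¬x rewrite dec-false a? ¬x = refl

𝟙<-cong : {x x′ y y′ : Fin n} → x ≡ x′ → y ≡ y′ → 𝟙 (x <? y) ≡ 𝟙 (x′ <? y′)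
𝟙<-cong = cong₂ (λ x y → 𝟙 (x <? y))

sum-exchange : {f g : Fin n → ℕ} {i : Fin n} → (∀ k → k ≢ i → f k ≡ g k) →
               sum f + g i ≡ sum g + f i
sum-exchange {suc n} {f} {g} {i} f≈g = begin
  sum f + g i                     ≡⟨ cong (_+ g i) (sum-remove {i = i} f) ⟩
  f i + sum (removeAt f i) + g i  ≡⟨ cong (λ s → f i + s + g i) removed ⟩
  f i + sum (removeAt g i) + g i  ≡⟨ xy∙z≈zy∙x (f i) _ (g i) ⟩
  g i + sum (removeAt g i) + f i  ≡⟨ cong (_+ f i) (sum-remove {i = i} g) ⟨
  sum g + f i                     ∎
  where
  open ≡-Reasoning
  removed : sum (removeAt f i) ≡ sum (removeAt g i)
  removed = sum-cong-≗ (λ k → f≈g (punchIn i k) (punchInᵢ≢i i k))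

sum-exchange₂ : {f g : Fin n → ℕ} {i j : Fin n} → i ≢ j →
                (∀ k → k ≢ i → k ≢ j → f k ≡ g k) → sum f + (g i + g j) ≡ sum g + (f i + f j)
sum-exchange₂ {n} {f} {g} {i} {j} i≢j f≈g = begin
  sum f + (g i + g j)  ≡⟨ +-assoc (sum f) (g i) (g j) ⟨
  sum f + g i + g j    ≡⟨ cong (λ x → sum f + x + g j) (updateAt-updates i f) ⟨
  sum f + h i + g j    ≡⟨ cong (_+ g j) (sum-exchange f≈h) ⟩
  sum h + f i + g j    ≡⟨ xy∙z≈xz∙y (sum h) (f i) (g j) ⟩
  sum h + g j + f i    ≡⟨ cong (_+ f i) (sum-exchange h≈g) ⟩
  sum g + h j + f i    ≡⟨ cong (λ x → sum g + x + f i) (updateAt-minimal j i f (i≢j ∘ sym)) ⟩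
  sum g + f j + f i    ≡⟨ xy∙z≈xz∙y (sum g) (f j) (f i) ⟩
  sum g + f i + f j    ≡⟨ +-assoc (sum g) (f i) (f j) ⟩
  sum g + (f i + f j)  ∎
  where
  open ≡-Reasoning
  h : Fin n → ℕ
  h = updateAt f i (λ _ → g i)
  f≈h : ∀ k → k ≢ i → f k ≡ h k
  f≈h k k≢i = sym (updateAt-minimal k i f k≢i)
  h≈g : ∀ k → k ≢ j → h k ≡ g k
  h≈g k k≢j with k ≟ i
  ... | yes refl = updateAt-updates i f
  ... | no k≢i   = trans (updateAt-minimal k i f k≢i) (f≈g k k≢i k≢j)

sum-offset₂ : {f g : Fin n → ℕ} {i j : Fin n} (c : ℕ) → i ≢ j →
              (∀ k → k ≢ i → k ≢ j → f k ≡ g k) → f i + f j ≡ c + (g i + g j) → sum f ≡ c + sum g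
sum-offset₂ {f = f} {g} {i} {j} c i≢j f≈g fi+fj = +-cancelʳ-≡ (g i + g j) (sum f) (c + sum g) (begin
  sum f + (g i + g j)        ≡⟨ sum-exchange₂ i≢j f≈g ⟩
  sum g + (f i + f j)        ≡⟨ cong (sum g +_) fi+fj ⟩
  sum g + (c + (g i + g j))  ≡⟨ +-assoc (sum g) c (g i + g j) ⟨
  sum g + c + (g i + g j)    ≡⟨ cong (_+ (g i + g j)) (+-comm (sum g) c) ⟩
  c + sum g + (g i + g j)    ∎)
  where open ≡-Reasoning

length-filter-tabulate : {P : Pred A ρ} (P? : Decidable P) (f : Fin n → A) →
                         length (filter P? (tabulate f)) ≡ ∑[ k < n ] 𝟙 (P? (f k))
length-filter-tabulate {n = zero}  P? f = refl
length-filter-tabulate {n = suc n} P? f with does (P? (f Fin.zero))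
... | true  = cong suc (length-filter-tabulate P? (f ∘ Fin.suc))
... | false = length-filter-tabulate P? (f ∘ Fin.suc)

length-filter-cartesianProduct :
  {P : Pred (A × B) ρ} (P? : Decidable P) (f : Fin n → A) (ys : List B) →
  length (filter P? (cartesianProduct (tabulate f) ys)) ≡ ∑[ i < n ] length (filter P? (map (f i ,_) ys))
length-filter-cartesianProduct {n = zero} P? f ys = refl
length-filter-cartesianProduct {A = A} {B = B} {n = suc n} P? f ys = begin
  length (filter P? (first ++ rest))                  ≡⟨ cong length (filter-++ P? first rest) ⟩
  length (filter P? first ++ filter P? rest)          ≡⟨ length-++ (filter P? first) ⟩
  length (filter P? first) + length (filter P? rest)  ≡⟨ cong (length (filter P? first) +_)
                                                              (length-filter-cartesianProduct P? (f ∘ Fin.suc) ys) ⟩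
  length (filter P? first) + ∑[ i < n ] length (filter P? (map (f (Fin.suc i) ,_) ys)) ∎
  where
  open ≡-Reasoning
  first rest : List (A × B)
  first = map (f Fin.zero ,_) ys
  rest  = cartesianProduct (tabulate (f ∘ Fin.suc)) ys

inversion? : (f : Fin n → Fin m) (i j : Fin n) → Dec (i < j × f j < f i)
inversion? f i j = (i <? j) ×-dec (f j <? f i)

χ : (Fin n → Fin m) → Fin n → Fin n → ℕ
χ f i j = 𝟙 (inversion? f i j)

inversionsFrom : (Fin n → Fin m) → Fin n → ℕ
inversionsFrom {n} f i = ∑[ j < n ] χ f i j

inversions : (Fin n → Fin m) → ℕ
inversions {n} f = ∑[ i < n ] inversionsFrom f i

χ-ordered : (f : Fin n → Fin m) {i j : Fin n} → i < j → χ f i j ≡ 𝟙 (f j <? f i)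
χ-ordered f {i} {j} i<j = 𝟙-⇔ (mk⇔ proj₂ (i<j ,_)) (inversion? f i j) (f j <? f i)

χ-unordered : (f : Fin n → Fin m) {i j : Fin n} → ¬ i < j → χ f i j ≡ 0
χ-unordered f {i} {j} i≮j = 𝟙-no (inversion? f i j) (i≮j ∘ proj₁)

inversions-cong : {f g : Fin n → Fin m} → f ≗ g → inversions f ≡ inversions g
inversions-cong f≗g = sum-cong-≗ λ i → sum-cong-≗ λ j →
  cong₂ (λ x y → 𝟙 ((i <? j) ×-dec (x <? y))) (f≗g j) (f≗g i)

ℓ≡inversions : (w : Permutation′ n) → ℓ w ≡ inversions (w ⟨$⟩ʳ_)
ℓ≡inversions {n} w = begin
  ℓ w
    ≡⟨ length-filter-cartesianProduct P? id (allFin n) ⟩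
  ∑[ i < n ] length (filter P? (map (i ,_) (allFin n)))
    ≡⟨ sum-cong-≗ (λ i → cong (length ∘ filter P?) (map-tabulate id (i ,_))) ⟩
  ∑[ i < n ] length (filter P? (tabulate (i ,_)))
    ≡⟨ sum-cong-≗ (λ i → length-filter-tabulate P? (i ,_)) ⟩
  inversions (w ⟨$⟩ʳ_)
    ∎
  where
  open ≡-Reasoning
  P? : Decidable {A = Fin n × Fin n} (λ (i , j) → i < j × w ⟨$⟩ʳ j < w ⟨$⟩ʳ i)
  P? (i , j) = inversion? (w ⟨$⟩ʳ_) i j

transpose-matchˡ : (i j : Fin n) → PC.transpose i j i ≡ j
transpose-matchˡ i j rewrite dec-true (i ≟ i) refl = refl

transpose-matchʳ : (i j : Fin n) → PC.transpose i j j ≡ i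
transpose-matchʳ i j with j ≟ i
... | yes j≡i = j≡i
... | no  _   rewrite dec-true (j ≟ j) refl = refl

transpose-other : {i j k : Fin n} → k ≢ i → k ≢ j → PC.transpose i j k ≡ k
transpose-other {i = i} {j} {k} k≢i k≢j rewrite dec-false (k ≟ i) k≢i | dec-false (k ≟ j) k≢j = refl

MinimalNonInversion : (Fin n → Fin m) → Fin n → Fin n → Set
MinimalNonInversion f i j = i < j × f i < f j × (∀ k → i < k → k < j → ¬ (f i < f k × f k < f j))

-- Exchanging the values at i and j only affects rows and columns i and j of the
-- inversion table. By minimality each k strictly between i and j has f k on the same
-- side of f i as of f j, so its contributions cancel, and (i , j) is the one new
-- inversion.
module _ {f : Fin n → Fin m} (f-injective : Injective _≡_ _≡_ f)
         {i j : Fin n} (minimal : MinimalNonInversion f i j) where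

  private
    i<j : i < j
    i<j = proj₁ minimal

    fi<fj : f i < f j
    fi<fj = proj₁ (proj₂ minimal)

    i≢j : i ≢ j
    i≢j = <⇒≢ i<j

    g : Fin n → Fin m
    g = f ∘ PC.transpose i j

    g-i : g i ≡ f j
    g-i = cong f (transpose-matchˡ i j)

    g-j : g j ≡ f i
    g-j = cong f (transpose-matchʳ i j)

    g-other : {k : Fin n} → k ≢ i → k ≢ j → g k ≡ f k
    g-other k≢i k≢j = cong f (transpose-other k≢i k≢j)

    outside : {k : Fin n} → i < k → k < j → f k < f i ⊎ f j < f k
    outside {k} i<k k<j with <-cmp (f k) (f i) | <-cmp (f k) (f j)
    ... | tri< fk<fi _ _ | _              = inj₁ fk<fi
    ... | tri≈ _ fk≡fi _ | _              = contradiction (f-injective fk≡fi) (<⇒≢ i<k ∘ sym)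
    ... | tri> _ _ _     | tri≈ _ fk≡fj _ = contradiction (f-injective fk≡fj) (<⇒≢ k<j)
    ... | tri> _ _ _     | tri> _ _ fj<fk = inj₂ fj<fk
    ... | tri> _ _ fi<fk | tri< fk<fj _ _ = contradiction (fi<fk , fk<fj) (proj₂ (proj₂ minimal) k i<k k<j)

    above-i⇔above-j : {k : Fin n} → i < k → k < j → f i < f k ⇔ f j < f k
    above-i⇔above-j i<k k<j with outside i<k k<j
    ... | inj₁ fk<fi = mk⇔ (λ fi<fk → contradiction fi<fk (<-asym fk<fi))
                           (λ fj<fk → contradiction (<-trans fk<fi fi<fj) (<-asym fj<fk))
    ... | inj₂ fj<fk = mk⇔ (λ _ → fj<fk) (λ _ → <-trans fi<fj fj<fk)

    below-j⇔below-i : {k : Fin n} → i < k → k < j → f k < f j ⇔ f k < f i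
    below-j⇔below-i i<k k<j with outside i<k k<j
    ... | inj₁ fk<fi = mk⇔ (λ _ → fk<fi) (λ _ → <-trans fk<fi fi<fj)
    ... | inj₂ fj<fk = mk⇔ (λ fk<fj → contradiction fk<fj (<-asym fj<fk))
                           (λ fk<fi → contradiction (<-trans fi<fj fj<fk) (<-asym fk<fi))

    χ-unordered-pair : {a b : Fin n} → ¬ a < b → χ g a b ≡ χ f a b
    χ-unordered-pair a≮b = trans (χ-unordered g a≮b) (sym (χ-unordered f a≮b))

    columns-i-j-of-row : ∀ a → a ≢ i → a ≢ j → χ g a i + χ g a j ≡ χ f a i + χ f a j
    columns-i-j-of-row a a≢i a≢j with <-cmp a i | <-cmp a j
    ... | tri≈ _ a≡i _ | _            = contradiction a≡i a≢i
    ... | _            | tri≈ _ a≡j _ = contradiction a≡j a≢j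
    ... | tri< a<i _ _ | tri> _ _ j<a = contradiction (<-trans i<j j<a) (<-asym a<i)
    ... | tri> a≮i _ _ | tri> a≮j _ _ = cong₂ _+_ (χ-unordered-pair a≮i) (χ-unordered-pair a≮j)
    ... | tri< a<i _ _ | tri< a<j _ _ = begin
      χ g a i + χ g a j                ≡⟨ cong₂ _+_ (χ-ordered g a<i) (χ-ordered g a<j) ⟩
      𝟙 (g i <? g a) + 𝟙 (g j <? g a)  ≡⟨ cong₂ _+_ (𝟙<-cong g-i ga) (𝟙<-cong g-j ga) ⟩
      𝟙 (f j <? f a) + 𝟙 (f i <? f a)  ≡⟨ +-comm (𝟙 (f j <? f a)) _ ⟩
      𝟙 (f i <? f a) + 𝟙 (f j <? f a)  ≡⟨ cong₂ _+_ (χ-ordered f a<i) (χ-ordered f a<j) ⟨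
      χ f a i + χ f a j                ∎
      where
      open ≡-Reasoning
      ga : g a ≡ f a
      ga = g-other a≢i a≢j
    ... | tri> a≮i _ i<a | tri< a<j _ _ = cong₂ _+_ (χ-unordered-pair a≮i) (begin
      χ g a j         ≡⟨ χ-ordered g a<j ⟩
      𝟙 (g j <? g a)  ≡⟨ 𝟙<-cong g-j (g-other a≢i a≢j) ⟩
      𝟙 (f i <? f a)  ≡⟨ 𝟙-⇔ (above-i⇔above-j i<a a<j) (f i <? f a) (f j <? f a) ⟩
      𝟙 (f j <? f a)  ≡⟨ χ-ordered f a<j ⟨
      χ f a j         ∎)
      where open ≡-Reasoning

    rows-i-j-at-column : ∀ b → b ≢ j → χ g i b + χ g j b ≡ χ f i b + χ f j b
    rows-i-j-at-column b b≢j with <-cmp i b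
    ... | tri≈ i≮b _ _ = cong₂ _+_ (χ-unordered-pair i≮b) (χ-unordered-pair (i≮b ∘ <-trans i<j))
    ... | tri> i≮b _ _ = cong₂ _+_ (χ-unordered-pair i≮b) (χ-unordered-pair (i≮b ∘ <-trans i<j))
    ... | tri< i<b _ _ with <-cmp j b
    ...   | tri≈ _ j≡b _   = contradiction (sym j≡b) b≢j
    ...   | tri> j≮b _ b<j = cong₂ _+_ (begin
      χ g i b         ≡⟨ χ-ordered g i<b ⟩
      𝟙 (g b <? g i)  ≡⟨ 𝟙<-cong (g-other (<⇒≢ i<b ∘ sym) b≢j) g-i ⟩
      𝟙 (f b <? f j)  ≡⟨ 𝟙-⇔ (below-j⇔below-i i<b b<j) (f b <? f j) (f b <? f i) ⟩
      𝟙 (f b <? f i)  ≡⟨ χ-ordered f i<b ⟨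
      χ f i b         ∎) (χ-unordered-pair j≮b)
      where open ≡-Reasoning
    ...   | tri< j<b _ _   = begin
      χ g i b + χ g j b                ≡⟨ cong₂ _+_ (χ-ordered g i<b) (χ-ordered g j<b) ⟩
      𝟙 (g b <? g i) + 𝟙 (g b <? g j)  ≡⟨ cong₂ _+_ (𝟙<-cong gb g-i) (𝟙<-cong gb g-j) ⟩
      𝟙 (f b <? f j) + 𝟙 (f b <? f i)  ≡⟨ +-comm (𝟙 (f b <? f j)) _ ⟩
      𝟙 (f b <? f i) + 𝟙 (f b <? f j)  ≡⟨ cong₂ _+_ (χ-ordered f i<b) (χ-ordered f j<b) ⟨
      χ f i b + χ f j b                ∎
      where
      open ≡-Reasoning
      gb : g b ≡ f b
      gb = g-other (<⇒≢ i<b ∘ sym) (<⇒≢ j<b ∘ sym)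

    rows-i-j-at-column-j : χ g i j + χ g j j ≡ 1 + (χ f i j + χ f j j)
    rows-i-j-at-column-j = begin
      χ g i j + χ g j j        ≡⟨ cong₂ _+_ χg-i-j (χ-unordered g {j} (<-irrefl refl)) ⟩
      1 + 0                    ≡⟨ cong₂ (λ x y → 1 + (x + y)) χf-i-j (χ-unordered f {j} (<-irrefl refl)) ⟨
      1 + (χ f i j + χ f j j)  ∎
      where
      open ≡-Reasoning
      χg-i-j : χ g i j ≡ 1
      χg-i-j = 𝟙-yes (inversion? g i j) (i<j , subst₂ _<_ (sym g-j) (sym g-i) fi<fj)
      χf-i-j : χ f i j ≡ 0
      χf-i-j = 𝟙-no (inversion? f i j) (<-asym fi<fj ∘ proj₂)

    row-other : ∀ a → a ≢ i → a ≢ j → inversionsFrom g a ≡ inversionsFrom f a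
    row-other a a≢i a≢j = sum-offset₂ 0 i≢j columns-other (columns-i-j-of-row a a≢i a≢j)
      where
      columns-other : ∀ b → b ≢ i → b ≢ j → χ g a b ≡ χ f a b
      columns-other b b≢i b≢j =
        cong₂ (λ x y → 𝟙 ((a <? b) ×-dec (x <? y))) (g-other b≢i b≢j) (g-other a≢i a≢j)

    rows-i-j : inversionsFrom g i + inversionsFrom g j ≡ 1 + (inversionsFrom f i + inversionsFrom f j)
    rows-i-j = begin
      inversionsFrom g i + inversionsFrom g j
        ≡⟨ ∑-distrib-+ (χ g i) (χ g j) ⟨
      ∑[ b < n ] (χ g i b + χ g j b)
        ≡⟨ sum-offset₂ 1 i≢j (λ b _ → rows-i-j-at-column b) columns-i-j ⟩
      1 + ∑[ b < n ] (χ f i b + χ f j b)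
        ≡⟨ cong (1 +_) (∑-distrib-+ (χ f i) (χ f j)) ⟩
      1 + (inversionsFrom f i + inversionsFrom f j)
        ∎
      where
      open ≡-Reasoning
      columns-i-j : χ g i i + χ g j i + (χ g i j + χ g j j)
                  ≡ 1 + (χ f i i + χ f j i + (χ f i j + χ f j j))
      columns-i-j = trans (cong₂ _+_ (rows-i-j-at-column i i≢j) rows-i-j-at-column-j) (+-suc _ _)

  inversions-transpose : inversions (f ∘ PC.transpose i j) ≡ suc (inversions f)
  inversions-transpose = sum-offset₂ 1 i≢j row-other rows-i-j

⟨$⟩ʳ-injective : (π : Permutation′ n) → Injective _≡_ _≡_ (π ⟨$⟩ʳ_)
⟨$⟩ʳ-injective π = Injection.injective (↔⇒↣ π)

ℓ-cong : {u v : Permutation′ n} → u ≈ₚ v → ℓ u ≡ ℓ v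
ℓ-cong {u = u} {v} u≈v = begin
  ℓ u                   ≡⟨ ℓ≡inversions u ⟩
  inversions (u ⟨$⟩ʳ_)  ≡⟨ inversions-cong u≈v ⟩
  inversions (v ⟨$⟩ʳ_)  ≡⟨ ℓ≡inversions v ⟨
  ℓ v                   ∎
  where open ≡-Reasoning

ℓ-·t : {u : Permutation′ n} {i j : Fin n} → MinimalNonInversion (u ⟨$⟩ʳ_) i j →
       ℓ (u ·t[ i , j ]) ≡ suc (ℓ u)
ℓ-·t {u = u} {i} {j} minimal = begin
  ℓ (u ·t[ i , j ])                          ≡⟨ ℓ≡inversions (u ·t[ i , j ]) ⟩
  inversions ((u ⟨$⟩ʳ_) ∘ PC.transpose i j)  ≡⟨ inversions-transpose (⟨$⟩ʳ-injective u) minimal ⟩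
  suc (inversions (u ⟨$⟩ʳ_))                 ≡⟨ cong suc (ℓ≡inversions u) ⟨
  suc (ℓ u)                                  ∎
  where open ≡-Reasoning

record _⋖_ (u v : Permutation′ n) : Set where
  constructor _,_
  field
    step  : BruhatStep u v
    ℓ-suc : ℓ v ≡ suc (ℓ u)

⋖-·t : {u v : Permutation′ n} {i j : Fin n} → MinimalNonInversion (u ⟨$⟩ʳ_) i j →
       v ≈ₚ (u ·t[ i , j ]) → u ⋖ v
⋖-·t {u = u} {v} {i} {j} minimal v≈ut =
  (i , j , <⇒≢ (proj₁ minimal) , v≈ut , ≤-reflexive (sym ℓv)) , ℓv
  where
  ℓv : ℓ v ≡ suc (ℓ u)
  ℓv = trans (ℓ-cong {u = v} {u ·t[ i , j ]} v≈ut) (ℓ-·t {u = u} minimal)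

<B⇒ℓ< : {u v : Permutation′ n} → u <B v → ℓ u ℕ.< ℓ v
<B⇒ℓ< [ (_ , _ , _ , _ , ℓu<ℓv) ]      = ℓu<ℓv
<B⇒ℓ< ((_ , _ , _ , _ , ℓu<ℓv) ∷ v<w) = ℕ.<-trans ℓu<ℓv (<B⇒ℓ< v<w)

⋖⇒CoversIn : {u v w : Permutation′ n} → u ⋖ v → v ⋖ w → CoversIn w u v
⋖⇒CoversIn {u = u} {v} {w} (u→v , ℓv) (v→w , _) =
  inj₂ (_∷_ {y = v} u→v [ v→w ]) , inj₂ [ v→w ] , [ u→v ] , nothing-between
  where
  nothing-between : ∀ z → z ≤B w → ¬ (u <B z × z <B v)
  nothing-between z _ (u<z , z<v) = <⇒≱ (<B⇒ℓ< u<z) (m<1+n⇒m≤n (subst (ℓ z ℕ.<_) ℓv (<B⇒ℓ< z<v)))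

¬-between-cong : {x x′ y y′ z z′ : Fin n} → x ≡ x′ → y ≡ y′ → z ≡ z′ →
                 ¬ (x′ < y′ × y′ < z′) → ¬ (x < y × y < z)
¬-between-cong refl refl refl = id

module AdjacentMinimalInversions {n : ℕ} (w : Permutation′ n) {p q r : Fin n} (avoids : Avoids4231 w)
                                 (pq : MinimalInversion w p q) (qr : MinimalInversion w q r) where

  private
    a b c : Fin n
    a = w ⟨$⟩ʳ p
    b = w ⟨$⟩ʳ q
    c = w ⟨$⟩ʳ r

    p<q : p < q
    p<q = proj₁ pq
    q<r : q < r
    q<r = proj₁ qr
    b<a : b < a
    b<a = proj₁ (proj₂ pq)
    c<b : c < b
    c<b = proj₁ (proj₂ qr)

    p≢q : p ≢ q
    p≢q = <⇒≢ p<q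
    q≢r : q ≢ r
    q≢r = <⇒≢ q<r
    p≢r : p ≢ r
    p≢r = <⇒≢ (<-trans p<q q<r)

  gap : ∀ k → p < k → k < r → k ≢ q → ¬ (c < w ⟨$⟩ʳ k × w ⟨$⟩ʳ k < a)
  gap k p<k k<r k≢q (c<wk , wk<a) with <-cmp k q | <-cmp (w ⟨$⟩ʳ k) b
  ... | tri≈ _ k≡q _ | _             = k≢q k≡q
  ... | _            | tri≈ _ wk≡b _ = k≢q (⟨$⟩ʳ-injective w wk≡b)
  ... | tri< k<q _ _ | tri< wk<b _ _ = avoids p k q r p<k k<q q<r (c<wk , wk<b , b<a)
  ... | tri< k<q _ _ | tri> _ _ b<wk = proj₂ (proj₂ pq) k p<k k<q (b<wk , wk<a)
  ... | tri> _ _ q<k | tri< wk<b _ _ = proj₂ (proj₂ qr) k q<k k<r (c<wk , wk<b)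
  ... | tri> _ _ q<k | tri> _ _ b<wk = avoids p q k r p<q q<k k<r (c<b , b<wk , wk<a)

  record Profile (h : Permutation′ n) (x y z : Fin n) : Set where
    field
      at-p      : h ⟨$⟩ʳ p ≡ x
      at-q      : h ⟨$⟩ʳ q ≡ y
      at-r      : h ⟨$⟩ʳ r ≡ z
      elsewhere : ∀ {k} → k ≢ p → k ≢ q → k ≢ r → h ⟨$⟩ʳ k ≡ w ⟨$⟩ʳ k

  Profile-w : Profile w a b c
  Profile-w = record { at-p = refl ; at-q = refl ; at-r = refl ; elsewhere = λ _ _ _ → refl }

  Profile-·t-pq : ∀ {h x y z} → Profile h x y z → Profile (h ·t[ p , q ]) y x z
  Profile-·t-pq {h} P = record
    { at-p      = trans (cong (h ⟨$⟩ʳ_) (transpose-matchˡ p q)) at-q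
    ; at-q      = trans (cong (h ⟨$⟩ʳ_) (transpose-matchʳ p q)) at-p
    ; at-r      = trans (cong (h ⟨$⟩ʳ_) (transpose-other (p≢r ∘ sym) (q≢r ∘ sym))) at-r
    ; elsewhere = λ k≢p k≢q k≢r →
        trans (cong (h ⟨$⟩ʳ_) (transpose-other k≢p k≢q)) (elsewhere k≢p k≢q k≢r)
    }
    where open Profile P

  Profile-·t-qr : ∀ {h x y z} → Profile h x y z → Profile (h ·t[ q , r ]) x z y
  Profile-·t-qr {h} P = record
    { at-p      = trans (cong (h ⟨$⟩ʳ_) (transpose-other p≢q p≢r)) at-p
    ; at-q      = trans (cong (h ⟨$⟩ʳ_) (transpose-matchˡ q r)) at-r
    ; at-r      = trans (cong (h ⟨$⟩ʳ_) (transpose-matchʳ q r)) at-q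
    ; elsewhere = λ k≢p k≢q k≢r →
        trans (cong (h ⟨$⟩ʳ_) (transpose-other k≢q k≢r)) (elsewhere k≢p k≢q k≢r)
    }
    where open Profile P

  Profile-·t-pr : ∀ {h x y z} → Profile h x y z → Profile (h ·t[ p , r ]) z y x
  Profile-·t-pr {h} P = record
    { at-p      = trans (cong (h ⟨$⟩ʳ_) (transpose-matchˡ p r)) at-r
    ; at-q      = trans (cong (h ⟨$⟩ʳ_) (transpose-other (p≢q ∘ sym) q≢r)) at-q
    ; at-r      = trans (cong (h ⟨$⟩ʳ_) (transpose-matchʳ p r)) at-p
    ; elsewhere = λ k≢p k≢q k≢r →
        trans (cong (h ⟨$⟩ʳ_) (transpose-other k≢p k≢r)) (elsewhere k≢p k≢q k≢r)
    }
    where open Profile P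

  Profile-unique : ∀ {h h′ x y z} → Profile h x y z → Profile h′ x y z → h ≈ₚ h′
  Profile-unique P P′ k with k ≟ p | k ≟ q | k ≟ r
  ... | yes refl | _        | _        = trans (Profile.at-p P) (sym (Profile.at-p P′))
  ... | no _     | yes refl | _        = trans (Profile.at-q P) (sym (Profile.at-q P′))
  ... | no _     | no _     | yes refl = trans (Profile.at-r P) (sym (Profile.at-r P′))
  ... | no k≢p   | no k≢q   | no k≢r   =
    trans (Profile.elsewhere P k≢p k≢q k≢r) (sym (Profile.elsewhere P′ k≢p k≢q k≢r))

  minimal-pq : ∀ {h x y z} → Profile h x y z → x < y →
               (∀ k → p < k → k < q → ¬ (x < w ⟨$⟩ʳ k × w ⟨$⟩ʳ k < y)) →
               MinimalNonInversion (h ⟨$⟩ʳ_) p q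
  minimal-pq P x<y none = p<q , subst₂ _<_ (sym at-p) (sym at-q) x<y , λ k p<k k<q →
    ¬-between-cong at-p (elsewhere (<⇒≢ p<k ∘ sym) (<⇒≢ k<q) (<⇒≢ (<-trans k<q q<r))) at-q
                   (none k p<k k<q)
    where open Profile P

  minimal-qr : ∀ {h x y z} → Profile h x y z → y < z →
               (∀ k → q < k → k < r → ¬ (y < w ⟨$⟩ʳ k × w ⟨$⟩ʳ k < z)) →
               MinimalNonInversion (h ⟨$⟩ʳ_) q r
  minimal-qr P y<z none = q<r , subst₂ _<_ (sym at-q) (sym at-r) y<z , λ k q<k k<r →
    ¬-between-cong at-q (elsewhere (<⇒≢ (<-trans p<q q<k) ∘ sym) (<⇒≢ q<k ∘ sym) (<⇒≢ k<r)) at-r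
                   (none k q<k k<r)
    where open Profile P

  minimal-pr : ∀ {h x y z} → Profile h x y z → x < z → ¬ (x < y × y < z) →
               (∀ k → p < k → k < r → k ≢ q → ¬ (x < w ⟨$⟩ʳ k × w ⟨$⟩ʳ k < z)) →
               MinimalNonInversion (h ⟨$⟩ʳ_) p r
  minimal-pr {h} P x<z y∉xz none =
    <-trans p<q q<r , subst₂ _<_ (sym at-p) (sym at-r) x<z , nothing-between
    where
    open Profile P
    nothing-between : ∀ k → p < k → k < r → ¬ (h ⟨$⟩ʳ p < h ⟨$⟩ʳ k × h ⟨$⟩ʳ k < h ⟨$⟩ʳ r)
    nothing-between k p<k k<r with k ≟ q
    ... | yes refl = ¬-between-cong at-p at-q at-r y∉xz
    ... | no k≢q   =
      ¬-between-cong at-p (elsewhere (<⇒≢ p<k ∘ sym) k≢q (<⇒≢ k<r)) at-r (none k p<k k<r k≢q)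

  private
    Profile-A : Profile (w ·t[ p , q ]) b a c
    Profile-A = Profile-·t-pq Profile-w
    Profile-B : Profile (w ·t[ q , r ]) a c b
    Profile-B = Profile-·t-qr Profile-w
    Profile-U₁ : Profile ((w ·t[ p , q ]) ·t[ q , r ]) b c a
    Profile-U₁ = Profile-·t-qr Profile-A
    Profile-U₂ : Profile ((w ·t[ q , r ]) ·t[ p , q ]) c a b
    Profile-U₂ = Profile-·t-pq Profile-B

  A⋖w : (w ·t[ p , q ]) ⋖ w
  A⋖w = ⋖-·t (minimal-pq Profile-A b<a (proj₂ (proj₂ pq)))
             (Profile-unique Profile-w (Profile-·t-pq Profile-A))

  B⋖w : (w ·t[ q , r ]) ⋖ w
  B⋖w = ⋖-·t (minimal-qr Profile-B c<b (proj₂ (proj₂ qr)))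
             (Profile-unique Profile-w (Profile-·t-qr Profile-B))

  U₁⋖A : ((w ·t[ p , q ]) ·t[ q , r ]) ⋖ (w ·t[ p , q ])
  U₁⋖A = ⋖-·t (minimal-qr Profile-U₁ (<-trans c<b b<a)
                 λ k q<k k<r → gap k (<-trans p<q q<k) k<r (<⇒≢ q<k ∘ sym))
              (Profile-unique Profile-A (Profile-·t-qr Profile-U₁))

  U₂⋖B : ((w ·t[ q , r ]) ·t[ p , q ]) ⋖ (w ·t[ q , r ])
  U₂⋖B = ⋖-·t (minimal-pq Profile-U₂ (<-trans c<b b<a)
                 λ k p<k k<q → gap k p<k (<-trans k<q q<r) (<⇒≢ k<q))
              (Profile-unique Profile-B (Profile-·t-pq Profile-U₂))

  U₂⋖A : ((w ·t[ q , r ]) ·t[ p , q ]) ⋖ (w ·t[ p , q ])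
  U₂⋖A = ⋖-·t (minimal-pr Profile-U₂ c<b (λ (_ , a<b) → <-asym a<b b<a)
                 λ k p<k k<r k≢q (c<wk , wk<b) → gap k p<k k<r k≢q (c<wk , <-trans wk<b b<a))
              (Profile-unique Profile-A (Profile-·t-pr Profile-U₂))

  U₁⋖B : ((w ·t[ p , q ]) ·t[ q , r ]) ⋖ (w ·t[ q , r ])
  U₁⋖B = ⋖-·t (minimal-pr Profile-U₁ b<a (λ (b<c , _) → <-asym b<c c<b)
                 λ k p<k k<r k≢q (b<wk , wk<a) → gap k p<k k<r k≢q (<-trans c<b b<wk , wk<a))
              (Profile-unique Profile-B (Profile-·t-pr Profile-U₁))

lemma3p6 : (n : ℕ) (w : Permutation′ n) (p q r : Fin n) →
    Avoids4231 w → MinimalInversion w p q → MinimalInversion w q r →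
    (CoversIn w ((w ·t[ p , q ]) ·t[ q , r ]) (w ·t[ p , q ]) ×
     CoversIn w ((w ·t[ q , r ]) ·t[ p , q ]) (w ·t[ p , q ])) ×
    (CoversIn w ((w ·t[ p , q ]) ·t[ q , r ]) (w ·t[ q , r ]) ×
     CoversIn w ((w ·t[ q , r ]) ·t[ p , q ]) (w ·t[ q , r ]))
lemma3p6 n w p q r avoids pq qr =
  (⋖⇒CoversIn U₁⋖A A⋖w , ⋖⇒CoversIn U₂⋖A A⋖w) ,
  (⋖⇒CoversIn U₁⋖B B⋖w , ⋖⇒CoversIn U₂⋖B B⋖w)
  where open AdjacentMinimalInversions w avoids pq qr
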